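{- For any odd integer $m\geq 3$, the graph $C_m[4]$ has no $\{C_4^1,C_m^3\}$-factorization; that is, the edge set of $C_m[4]$ cannot be partitioned into one $C_4$-factor and three $C_m$-factors.
   Context: For a graph $G$ and integer $k\geq 1$, $G[k]$ denotes the graph with vertex set $V(G)\times\{0,1,\dots,k-1\}$ in which $(u,i)$ and $(w,j)$ are adjacent if and only if $uw\in E(G)$. $C_m$ is the cycle of length $m$. A $C_\ell$-factor of a graph is a spanning subgraph that is a vertex-disjoint union of $\ell$-cycles. -}

module Defs where

open import Data.Nat using (ℕ; zero; suc; _+_; _*_)
open import Data.Fin using (Fin; toℕ)
open import Data.Product using (Σ; ∃; _×_; _,_)
open import Data.Sum using (_⊎_)
open import Function.Definitions using (Injective)
open import Relation.Binary.PropositionalEquality using (_≡_)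

Graph : Set → Set₁
Graph V = V → V → Set

Odd : ℕ → Set
Odd m = ∃ λ k → m ≡ suc (2 * k)

CycSucc : (ℓ : ℕ) → Fin ℓ → Fin ℓ → Set
CycSucc ℓ i j = (suc (toℕ i) ≡ toℕ j) ⊎ ((suc (toℕ i) ≡ ℓ) × (toℕ j ≡ 0))

Cyc : (m : ℕ) → Graph (Fin m)
Cyc m u w = CycSucc m u w ⊎ CycSucc m w u

Blow : {V : Set} → Graph V → (k : ℕ) → Graph (V × Fin k)
Blow G k (u , i) (w , j) = G u w

record Cycle {V : Set} (G : Graph V) (ℓ : ℕ) : Set where
  field
    vert   : Fin ℓ → V
    inj    : Injective _≡_ _≡_ vert
    adj    : ∀ i j → CycSucc ℓ i j → G (vert i) (vert j)
open Cycle public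

CycleEdge : {V : Set} {G : Graph V} {ℓ : ℕ} → Cycle G ℓ → V → V → Set
CycleEdge {ℓ = ℓ} c x y =
  ∃ λ i → ∃ λ j → CycSucc ℓ i j ×
    (((vert c i ≡ x) × (vert c j ≡ y)) ⊎ ((vert c i ≡ y) × (vert c j ≡ x)))

record Factor {V : Set} (G : Graph V) (ℓ : ℕ) : Set₁ where
  field
    Idx      : Set
    cyc      : Idx → Cycle G ℓ
    covers   : ∀ v → ∃ λ a → ∃ λ i → vert (cyc a) i ≡ v
    disjoint : ∀ a b i j → vert (cyc a) i ≡ vert (cyc b) j → a ≡ b
open Factor public

FactorEdge : {V : Set} {G : Graph V} {ℓ : ℕ} → Factor G ℓ → V → V → Set
FactorEdge F x y = ∃ λ a → CycleEdge (cyc F a) x y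

len : ℕ → Fin 4 → ℕ
len m Fin.zero = 4
len m (Fin.suc _) = m

record Factorization {V : Set} (G : Graph V) (m : ℕ) : Set₁ where
  field
    fac      : (t : Fin 4) → Factor G (len m t)
    cover    : ∀ x y → G x y → ∃ λ t → FactorEdge (fac t) x y
    disjoint : ∀ t s x y → FactorEdge (fac t) x y → FactorEdge (fac s) x y → t ≡ s

-- Fix a C₄-factor cycle c of C_m[4]. Its projection to C_m is a closed walk of length 4,
-- and for odd m ≥ 3 such a walk backtracks: some vertex v of c has both c-neighbours in
-- one fibre {u} × Fin 4. Let w ≠ u be the other neighbour of the projection L of v.
-- None of the four edges from v to {w} × Fin 4 lies in the C₄-factor, so two of them lie
-- in the same C_m-factor. But an m-cycle of C_m[4] projects bijectively onto C_m (a
-- projection missing a vertex would be an odd closed walk in a path), so each C_m-factor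
-- has at most one edge from v into each fibre.
module Submission where

open import Defs
open import Data.Nat using (ℕ; _≤_)
open import Relation.Nullary using (¬_)

open import Data.Nat.Base using (zero; suc; _+_; _*_; _∸_; _<_; s≤s; parity)
open import Data.Nat.Properties
  using ( suc-injective; 1+n≢0; <-irrefl; <-trans; ≤-trans; ≤-antisym; ≤-pred; ≮⇒≥
        ; ≤∧≢⇒<; <-≤-trans; n<1+n; m<n⇒m<1+n; m≤m+n; m≤n+m; +-suc
        ; +-cancelʳ-≡; +-∸-assoc; ∸-cancelʳ-≡; ∸-monoˡ-<; _<?_ )
open import Data.Parity.Base as ℙ using (1ℙ; 0ℙ; _⁻¹)
import Data.Parity.Properties as ℙₚ
open import Data.Fin.Base using (Fin; zero; suc; toℕ; fromℕ<; fromℕ; inject₁; punchIn; punchOut)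
open import Data.Fin.Patterns using (0F; 1F; 2F; 3F)
open import Data.Fin.Properties
  using ( toℕ-injective; toℕ<n; toℕ-fromℕ<; toℕ-fromℕ; toℕ-inject₁; _≟_; any?; ¬∀⟶∃¬
        ; pigeonhole; <⇒notInjective; <⇒≢; punchOut-injective; punchIn-punchOut )
open import Data.Product using (∃; _×_; _,_; proj₁; proj₂)
open import Data.Sum using (_⊎_; inj₁; inj₂)
import Data.Sum as Sum
open import Data.Empty using (⊥-elim)
open import Function using (_∘_)
open import Function.Definitions using (Injective)
open import Relation.Nullary using (yes; no; contradiction)
open import Relation.Binary.PropositionalEquality
  using (_≡_; _≢_; refl; sym; trans; cong; subst; module ≡-Reasoning)

ClosedWalk : {V : Set} → Graph V → (ℓ : ℕ) → (Fin ℓ → V) → Set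
ClosedWalk G ℓ f = ∀ i j → CycSucc ℓ i j → G (f i) (f j)

ℕ-path : Graph ℕ
ℕ-path a b = suc a ≡ b ⊎ suc b ≡ a

CycSucc-functional : ∀ {ℓ} {i j j′ : Fin ℓ} → CycSucc ℓ i j → CycSucc ℓ i j′ → j ≡ j′
CycSucc-functional (inj₁ e) (inj₁ e′) = toℕ-injective (trans (sym e) e′)
CycSucc-functional {j = j} (inj₁ e) (inj₂ (e′ , _)) = ⊥-elim (<-irrefl (trans (sym e) e′) (toℕ<n j))
CycSucc-functional {j′ = j′} (inj₂ (e , _)) (inj₁ e′) = ⊥-elim (<-irrefl (trans (sym e′) e) (toℕ<n j′))
CycSucc-functional (inj₂ (_ , e)) (inj₂ (_ , e′)) = toℕ-injective (trans e (sym e′))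

CycSucc-injective : ∀ {ℓ} {i i′ j : Fin ℓ} → CycSucc ℓ i j → CycSucc ℓ i′ j → i ≡ i′
CycSucc-injective (inj₁ e) (inj₁ e′) = toℕ-injective (suc-injective (trans e (sym e′)))
CycSucc-injective (inj₁ e) (inj₂ (_ , e′)) = ⊥-elim (1+n≢0 (trans e e′))
CycSucc-injective (inj₂ (_ , e)) (inj₁ e′) = ⊥-elim (1+n≢0 (trans e′ e))
CycSucc-injective (inj₂ (e , _)) (inj₂ (e′ , _)) = toℕ-injective (suc-injective (trans e (sym e′)))

CycSucc-irreflexive : ∀ {ℓ} → 1 < ℓ → (i : Fin ℓ) → ¬ CycSucc ℓ i i
CycSucc-irreflexive _ i (inj₁ e) = <-irrefl (sym e) (n<1+n (toℕ i))
CycSucc-irreflexive 1<ℓ i (inj₂ (e , e′)) = <-irrefl (sym (trans (sym e) (cong suc e′))) 1<ℓ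

CycSucc-asymmetric : ∀ {ℓ} → 3 ≤ ℓ → {i j : Fin ℓ} → CycSucc ℓ i j → ¬ CycSucc ℓ j i
CycSucc-asymmetric {ℓ} 3≤ℓ {i} {j} = asym (toℕ i) (toℕ j)
  where
  asym : ∀ a b → (suc a ≡ b ⊎ suc a ≡ ℓ × b ≡ 0) → ¬ (suc b ≡ a ⊎ suc b ≡ ℓ × a ≡ 0)
  asym a b (inj₁ refl) (inj₁ ())
  asym a b (inj₁ refl) (inj₂ (e , refl)) = <-irrefl e 3≤ℓ
  asym a b (inj₂ (e , refl)) (inj₁ refl) = <-irrefl e 3≤ℓ
  asym a b (inj₂ (e , refl)) (inj₂ (_ , refl)) = <-irrefl e (<-trans (n<1+n 1) 3≤ℓ)

successor : ∀ {ℓ} (i : Fin ℓ) → ∃ (CycSucc ℓ i)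
successor {suc n} i with suc (toℕ i) <? suc n
... | yes p = fromℕ< p , inj₁ (sym (toℕ-fromℕ< p))
... | no ¬p = zero , inj₂ (≤-antisym (toℕ<n i) (≮⇒≥ ¬p) , refl)

predecessor : ∀ {ℓ} (j : Fin ℓ) → ∃ λ i → CycSucc ℓ i j
predecessor {suc n} zero = fromℕ n , inj₂ (cong suc (toℕ-fromℕ n) , refl)
predecessor (suc j) = inject₁ j , inj₁ (cong suc (toℕ-inject₁ j))

Cyc-irreflexive : ∀ {m} → 1 < m → {y z : Fin m} → Cyc m y z → y ≢ z
Cyc-irreflexive 1<m (inj₁ y→z) refl = CycSucc-irreflexive 1<m _ y→z
Cyc-irreflexive 1<m (inj₂ z→y) refl = CycSucc-irreflexive 1<m _ z→y

Cyc-other-neighbour : ∀ {m} → 3 ≤ m → {v u : Fin m} → Cyc m v u → ∃ λ w → Cyc m v w × w ≢ u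
Cyc-other-neighbour 3≤m {v} (inj₁ v→u) =
  let w , w→v = predecessor v in w , inj₂ w→v , λ { refl → CycSucc-asymmetric 3≤m v→u w→v }
Cyc-other-neighbour 3≤m {v} (inj₂ u→v) =
  let w , v→w = successor v in w , inj₁ v→w , λ { refl → CycSucc-asymmetric 3≤m u→v v→w }

missed-value : ∀ {n m} → n < m → (f : Fin n → Fin m) → ∃ λ x → ∀ i → f i ≢ x
missed-value {n} {m} n<m f =
  let x , unhit = ¬∀⟶∃¬ m (λ x → ∃ λ i → f i ≡ x) (λ x → any? λ i → f i ≟ x) not-surjective
  in x , λ i fi≡x → unhit (i , fi≡x)
  where
  not-surjective : ¬ (∀ x → ∃ λ i → f i ≡ x)
  not-surjective hit = <⇒notInjective n<m section-injective
    where
    section-injective : Injective _≡_ _≡_ (λ x → proj₁ (hit x))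
    section-injective {x} {y} e = trans (sym (proj₂ (hit x))) (trans (cong f e) (proj₂ (hit y)))

nonInjective⇒missed-value : ∀ {n} (f : Fin (suc n) → Fin (suc n)) {j j′} →
                            j ≢ j′ → f j ≡ f j′ → ∃ λ x → ∀ i → f i ≢ x
nonInjective⇒missed-value {n} f {j} {j′} j≢j′ fj≡fj′ with missed-value (n<1+n n) (f ∘ punchIn j′)
... | x , unhit = x , misses
  where
  misses : ∀ i → f i ≢ x
  misses i fi≡x with i ≟ j′
  ... | yes refl = unhit (punchOut (j≢j′ ∘ sym))
                     (trans (cong f (punchIn-punchOut (j≢j′ ∘ sym))) (trans fj≡fj′ fi≡x))
  ... | no i≢j′ = unhit (punchOut (i≢j′ ∘ sym)) (trans (cong f (punchIn-punchOut (i≢j′ ∘ sym))) fi≡x)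

Fin3-complement-unique : {x y z w : Fin 3} → x ≢ y → x ≢ z → y ≢ z → x ≢ w → y ≢ w → z ≡ w
Fin3-complement-unique {x} x≢y x≢z y≢z x≢w y≢w =
  punchOut-injective x≢z x≢w (punchOut-injective y′≢z′ y′≢w′ Fin1-unique)
  where
  y′≢z′ : punchOut x≢y ≢ punchOut x≢z
  y′≢z′ = y≢z ∘ punchOut-injective x≢y x≢z
  y′≢w′ : punchOut x≢y ≢ punchOut x≢w
  y′≢w′ = y≢w ∘ punchOut-injective x≢y x≢w
  Fin1-unique : punchOut y′≢z′ ≡ punchOut y′≢w′
  Fin1-unique with punchOut y′≢z′ | punchOut y′≢w′
  ... | zero | zero = refl

-- The position of y on the path x+1, x+2, …, m−1, 0, 1, …, x−1 (indices as naturals).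
heightℕ : ℕ → ℕ → ℕ → ℕ
heightℕ m x y with x <? y
... | yes _ = y ∸ suc x
... | no _ = y + (m ∸ suc x)

heightℕ-step : ∀ {m x y z} → x < m → y ≢ x → (suc y ≡ z ⊎ suc y ≡ m × z ≡ 0) →
               suc (heightℕ m x y) ≡ heightℕ m x z
heightℕ-step {x = x} {y} _ y≢x (inj₁ refl) with x <? y | x <? suc y
... | yes x<y | yes _ = sym (+-∸-assoc 1 x<y)
... | yes x<y | no x≮1+y = contradiction (m<n⇒m<1+n x<y) x≮1+y
... | no x≮y | yes x<1+y = contradiction (≤-antisym (≤-pred x<1+y) (≮⇒≥ x≮y)) (y≢x ∘ sym)
... | no _ | no _ = refl
heightℕ-step {x = x} {y} x<m y≢x (inj₂ (refl , refl)) with x <? y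
... | yes x<y = sym (+-∸-assoc 1 x<y)
... | no x≮y = contradiction (≤∧≢⇒< (≤-pred x<m) (y≢x ∘ sym)) x≮y

-- heightℕ m x is a rotation of {0, …, m−1}, so it is injective there even at y = x.
heightℕ-injective : ∀ {m x y z} → y < m → z < m → heightℕ m x y ≡ heightℕ m x z → y ≡ z
heightℕ-injective {m} {x} {y} {z} y<m z<m eq with x <? y | x <? z
... | yes x<y | yes x<z = ∸-cancelʳ-≡ x<y x<z eq
... | no _ | no _ = +-cancelʳ-≡ (m ∸ suc x) y z eq
... | yes x<y | no _ = ⊥-elim (<-irrefl eq (<-≤-trans (∸-monoˡ-< y<m x<y) (m≤n+m (m ∸ suc x) z)))
... | no _ | yes x<z = ⊥-elim (<-irrefl (sym eq) (<-≤-trans (∸-monoˡ-< z<m x<z) (m≤n+m (m ∸ suc x) y)))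

height : ∀ {m} → Fin m → Fin m → ℕ
height {m} x y = heightℕ m (toℕ x) (toℕ y)

height-adjacent : ∀ {m} {x y z : Fin m} → y ≢ x → z ≢ x → Cyc m y z → ℕ-path (height x y) (height x z)
height-adjacent {x = x} y≢x _ (inj₁ y→z) = inj₁ (heightℕ-step (toℕ<n x) (y≢x ∘ toℕ-injective) y→z)
height-adjacent {x = x} _ z≢x (inj₂ z→y) = inj₂ (heightℕ-step (toℕ<n x) (z≢x ∘ toℕ-injective) z→y)

height-injective : ∀ {m} (x : Fin m) {y z} → height x y ≡ height x z → y ≡ z
height-injective x {y} {z} eq = toℕ-injective (heightℕ-injective (toℕ<n y) (toℕ<n z) eq)

closedWalk-height : ∀ {m ℓ} {x : Fin m} {g : Fin ℓ → Fin m} → (∀ i → g i ≢ x) →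
                    ClosedWalk (Cyc m) ℓ g → ClosedWalk ℕ-path ℓ (height x ∘ g)
closedWalk-height avoid walk i j i→j = height-adjacent (avoid i) (avoid j) (walk i j i→j)

ℕ-path-parity : ∀ {a b} → ℕ-path a b → ∀ n → parity (b + suc n) ≡ parity (a + n)
ℕ-path-parity {a} (inj₁ refl) n = cong (parity ∘ suc) (+-suc a n)
ℕ-path-parity {b = b} (inj₂ refl) n = cong parity (+-suc b n)

parity-odd : ∀ k → parity (suc (2 * k)) ≡ 1ℙ
parity-odd k = trans (sym (ℙₚ.⁻¹-selfInverse (ℙₚ.suc-homo-⁻¹ (2 * k)))) (cong _⁻¹ (ℙₚ.*-homo-* 2 k))

-- Along the walk, parity (h n + n) is invariant; closing an odd walk would change it.
ℕ-path-no-odd-closedWalk : ∀ {ℓ} → Odd ℓ → (h : Fin ℓ → ℕ) → ¬ ClosedWalk ℕ-path ℓ h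
ℕ-path-no-odd-closedWalk {ℓ} (k , refl) h walk = 1ℙ≢0ℙ (begin
  1ℙ                           ≡⟨ parity-odd k ⟨
  parity (suc (2 * k))         ≡⟨ ℙₚ.+-cancelˡ-≡ (parity (h zero)) _ _ closing ⟩
  0ℙ                           ∎)
  where
  open ≡-Reasoning
  1ℙ≢0ℙ : 1ℙ ≢ 0ℙ
  1ℙ≢0ℙ ()
  invariant : ∀ n (n<ℓ : n < ℓ) → parity (h (fromℕ< n<ℓ) + n) ≡ parity (h zero + 0)
  invariant zero _ = refl
  invariant (suc n) 1+n<ℓ = trans (ℕ-path-parity (walk _ _ step) n) (invariant n n<ℓ)
    where
    n<ℓ : n < ℓ
    n<ℓ = <-trans (n<1+n n) 1+n<ℓ
    step : CycSucc ℓ (fromℕ< n<ℓ) (fromℕ< 1+n<ℓ)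
    step = inj₁ (trans (cong suc (toℕ-fromℕ< n<ℓ)) (sym (toℕ-fromℕ< 1+n<ℓ)))
  last<ℓ : 2 * k < ℓ
  last<ℓ = n<1+n (2 * k)
  closing : parity (h zero) ℙ.+ parity (suc (2 * k)) ≡ parity (h zero) ℙ.+ 0ℙ
  closing = begin
    parity (h zero) ℙ.+ parity (suc (2 * k))   ≡⟨ ℙₚ.+-homo-+ (h zero) (suc (2 * k)) ⟨
    parity (h zero + suc (2 * k))              ≡⟨ ℕ-path-parity (walk _ zero wrap) (2 * k) ⟩
    parity (h (fromℕ< last<ℓ) + 2 * k)         ≡⟨ invariant (2 * k) last<ℓ ⟩
    parity (h zero + 0)                        ≡⟨ ℙₚ.+-homo-+ (h zero) 0 ⟩
    parity (h zero) ℙ.+ 0ℙ                     ∎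
    where
    wrap : CycSucc ℓ (fromℕ< last<ℓ) zero
    wrap = inj₂ (cong suc (toℕ-fromℕ< last<ℓ) , refl)

ℕ-path-closedWalk₄ : ∀ {a b c d} → ℕ-path a b → ℕ-path b c → ℕ-path c d → ℕ-path d a →
                     a ≡ c ⊎ b ≡ d
ℕ-path-closedWalk₄ (inj₁ refl) (inj₂ refl) _ _ = inj₁ refl
ℕ-path-closedWalk₄ (inj₂ refl) (inj₁ refl) _ _ = inj₁ refl
ℕ-path-closedWalk₄ (inj₁ refl) (inj₁ refl) (inj₂ refl) _ = inj₂ refl
ℕ-path-closedWalk₄ (inj₁ refl) (inj₁ refl) (inj₁ refl) (inj₁ ())
ℕ-path-closedWalk₄ (inj₁ refl) (inj₁ refl) (inj₁ refl) (inj₂ ())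
ℕ-path-closedWalk₄ (inj₂ refl) (inj₂ refl) (inj₁ refl) _ = inj₂ refl
ℕ-path-closedWalk₄ (inj₂ refl) (inj₂ refl) (inj₂ refl) (inj₁ ())
ℕ-path-closedWalk₄ (inj₂ refl) (inj₂ refl) (inj₂ refl) (inj₂ ())

odd-closedWalk-injective : ∀ {m} → Odd m → {g : Fin m → Fin m} → ClosedWalk (Cyc m) m g →
                           Injective _≡_ _≡_ g
odd-closedWalk-injective odd@(_ , refl) {g} walk {i} {j} gi≡gj with i ≟ j
... | yes i≡j = i≡j
... | no i≢j = let x , avoid = nonInjective⇒missed-value g i≢j gi≡gj in
               ⊥-elim (ℕ-path-no-odd-closedWalk odd _ (closedWalk-height avoid walk))

Backtracks₄ : {V : Set} → (Fin 4 → V) → Set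
Backtracks₄ g = g 0F ≡ g 2F ⊎ g 1F ≡ g 3F

Cyc-closedWalk₄-backtracks : ∀ {m} → 4 < m → {g : Fin 4 → Fin m} → ClosedWalk (Cyc m) 4 g →
                             Backtracks₄ g
Cyc-closedWalk₄-backtracks 4<m {g} walk =
  let x , avoid = missed-value 4<m g
      hwalk = closedWalk-height avoid walk
  in Sum.map (height-injective x) (height-injective x)
       (ℕ-path-closedWalk₄ (hwalk 0F 1F (inj₁ refl)) (hwalk 1F 2F (inj₁ refl))
                           (hwalk 2F 3F (inj₁ refl)) (hwalk 3F 0F (inj₂ (refl , refl))))

Cyc₃-closedWalk₄-backtracks : {g : Fin 4 → Fin 3} → ClosedWalk (Cyc 3) 4 g → Backtracks₄ g
Cyc₃-closedWalk₄-backtracks {g} walk with g 0F ≟ g 2F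
... | yes g₀≡g₂ = inj₁ g₀≡g₂
... | no g₀≢g₂ = inj₂ (Fin3-complement-unique g₀≢g₂ (distinct 0F 1F (inj₁ refl))
                        (distinct 1F 2F (inj₁ refl) ∘ sym) (distinct 3F 0F (inj₂ (refl , refl)) ∘ sym)
                        (distinct 2F 3F (inj₁ refl)))
  where
  distinct : ∀ i j → CycSucc 4 i j → g i ≢ g j
  distinct i j i→j = Cyc-irreflexive (m<n⇒m<1+n (n<1+n 1)) (walk i j i→j)

odd-Cyc-closedWalk₄-backtracks : ∀ {m} → 3 ≤ m → Odd m → {g : Fin 4 → Fin m} →
                                 ClosedWalk (Cyc m) 4 g → Backtracks₄ g
odd-Cyc-closedWalk₄-backtracks (s≤s ()) (zero , refl)
odd-Cyc-closedWalk₄-backtracks _ (suc zero , refl) = Cyc₃-closedWalk₄-backtracks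
odd-Cyc-closedWalk₄-backtracks _ (suc (suc k) , refl) =
  Cyc-closedWalk₄-backtracks (s≤s (s≤s (s≤s (≤-trans (m≤m+n 2 _) (m≤n+m _ k)))))

factorEdge-at : ∀ {V} {G : Graph V} {ℓ} (F : Factor G ℓ) {a i x y} → vert (cyc F a) i ≡ x →
                FactorEdge F x y → ∃ λ j → Cyc ℓ i j × vert (cyc F a) j ≡ y
factorEdge-at F {a} {i} vᵢ≡x (b , i′ , j′ , i′→j′ , inj₁ (vᵢ′≡x , vⱼ′≡y))
  with refl ← Factor.disjoint F b a i′ i (trans vᵢ′≡x (sym vᵢ≡x))
  with refl ← inj (cyc F b) (trans vᵢ′≡x (sym vᵢ≡x)) = j′ , inj₁ i′→j′ , vⱼ′≡y
factorEdge-at F {a} {i} vᵢ≡x (b , i′ , j′ , i′→j′ , inj₂ (vᵢ′≡y , vⱼ′≡x))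
  with refl ← Factor.disjoint F b a j′ i (trans vⱼ′≡x (sym vᵢ≡x))
  with refl ← inj (cyc F b) (trans vⱼ′≡x (sym vᵢ≡x)) = i′ , inj₂ i′→j′ , vᵢ′≡y

factorEdge-fibre-unique : ∀ {m k} → Odd m → (F : Factor (Blow (Cyc m) k) m) → ∀ {v w q q′} →
                          FactorEdge F v (w , q) → FactorEdge F v (w , q′) → q ≡ q′
factorEdge-fibre-unique {m} {k} odd F {v} e e′
  with a , i , vᵢ≡v ← covers F v
  with j , _ , vⱼ≡wq ← factorEdge-at F vᵢ≡v e
  with j′ , _ , vⱼ′≡wq′ ← factorEdge-at F vᵢ≡v e′ =
  cong proj₂ (trans (sym vⱼ≡wq) (trans (cong (vert c) j≡j′) vⱼ′≡wq′))
  where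
  c : Cycle (Blow (Cyc m) k) m
  c = cyc F a
  j≡j′ : j ≡ j′
  j≡j′ = odd-closedWalk-injective odd (adj c) (trans (cong proj₁ vⱼ≡wq) (sym (cong proj₁ vⱼ′≡wq′)))

module _ {m} (3≤m : 3 ≤ m) (odd : Odd m) (Z : Factorization (Blow (Cyc m) 4) m) where

  private
    fac : (t : Fin 4) → Factor (Blow (Cyc m) 4) (len m t)
    fac = Factorization.fac Z

  C₄-factor-meets-fibre : ∀ v {w} → Cyc m (proj₁ v) w → ¬ (∀ r → ¬ FactorEdge (fac 0F) v (w , r))
  C₄-factor-meets-fibre v {w} L~w avoids =
    let r₁ , r₂ , r₁<r₂ , s₁≡s₂ = pigeonhole (n<1+n 3) (proj₁ ∘ colour) in
    <⇒≢ r₁<r₂ (factorEdge-fibre-unique odd (fac (suc _))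
      (subst (λ s → FactorEdge (fac (suc s)) v (w , r₁)) s₁≡s₂ (proj₂ (colour r₁)))
      (proj₂ (colour r₂)))
    where
    colour : ∀ r → ∃ λ s → FactorEdge (fac (suc s)) v (w , r)
    colour r with Factorization.cover Z v (w , r) L~w
    ... | zero , e = ⊥-elim (avoids r e)
    ... | suc s , e = s , e

  C₄-factor-no-backtrack : (a : Idx (fac 0F)) {p i q : Fin 4} → CycSucc 4 p i → CycSucc 4 i q →
                           proj₁ (vert (cyc (fac 0F) a) p) ≢ proj₁ (vert (cyc (fac 0F) a) q)
  C₄-factor-no-backtrack a {p} {i} {q} p→i i→q fold =
    let w , L~w , w≢u = Cyc-other-neighbour 3≤m (adj c i q i→q) in
    C₄-factor-meets-fibre (vert c i) L~w λ r e →
      let j , i~j , vⱼ≡wr = factorEdge-at (fac 0F) refl e in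
      w≢u (trans (sym (cong proj₁ vⱼ≡wr)) (neighbour-in-fibre i~j))
    where
    c : Cycle (Blow (Cyc m) 4) 4
    c = cyc (fac 0F) a
    neighbour-in-fibre : ∀ {j} → Cyc 4 i j → proj₁ (vert c j) ≡ proj₁ (vert c q)
    neighbour-in-fibre (inj₁ i→j) = cong (proj₁ ∘ vert c) (CycSucc-functional i→j i→q)
    neighbour-in-fibre (inj₂ j→i) = trans (cong (proj₁ ∘ vert c) (CycSucc-injective j→i p→i)) fold

lemma8 : (m : ℕ) → 3 ≤ m → Odd m → ¬ Factorization (Blow (Cyc m) 4) m
lemma8 m 3≤m odd@(_ , refl) Z
  with a , _ ← covers (Factorization.fac Z 0F) (zero , 0F)
  with odd-Cyc-closedWalk₄-backtracks 3≤m odd (adj (cyc (Factorization.fac Z 0F) a))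
... | inj₁ g₀≡g₂ = C₄-factor-no-backtrack 3≤m odd Z a {0F} {1F} {2F} (inj₁ refl) (inj₁ refl) g₀≡g₂
... | inj₂ g₁≡g₃ = C₄-factor-no-backtrack 3≤m odd Z a {3F} {0F} {1F} (inj₂ (refl , refl)) (inj₁ refl)
                     (sym g₁≡g₃)
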